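{- Let $d\leq n$ be natural numbers and let $A\subseteq \mathbb{F}_2^n$ satisfy $\lvert A\rvert > 2\binom{n}{\leq\lfloor d/2\rfloor}$. Then $\textsf{int-deg}(A+A)>d$, where $A+A=\{a+b\mid a,b\in A\}$.
   Context: $\mathbb{F}_2$ is the field with two elements. For a set $B\subseteq\mathbb{F}_2^n$ and a function $f:B\to\mathbb{F}_2$, $\deg_B(f)$ is the minimal total degree of a multilinear polynomial $P\in\mathbb{F}_2[x_1,\dots,x_n]$ with $P(b)=f(b)$ for all $b\in B$. The interpolation degree $\textsf{int-deg}(B)$ is the maximum of $\deg_B(f)$ over all functions $f:B\to\mathbb{F}_2$, i.e. the smallest $d$ such that every function $B\to\mathbb{F}_2$ agrees on $B$ with some polynomial of degree at most $d$. For integers $n,k\ge0$, $\binom{n}{\leq k}=\sum_{i=0}^{k}\binom{n}{i}$. -}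

module Defs where

open import Data.Bool using (Bool; true; false; _∧_; _xor_; not; _∨_)
open import Data.Nat using (ℕ; zero; suc; _+_; _≤_)
open import Data.Nat.Combinatorics using (_C_)
open import Data.Vec using (Vec; zipWith; foldr′)
open import Data.Fin.Subset using (Subset; ∣_∣)
open import Data.List using (List; foldr)
open import Data.List.Relation.Unary.All using (All)
open import Data.List.Membership.Propositional using (_∈_)
open import Data.Product using (Σ; _×_; ∃)
open import Relation.Binary.PropositionalEquality using (_≡_)

-- 𝔽₂ is modelled by Bool (addition = xor, multiplication = ∧).
-- Points of 𝔽₂ⁿ
Point : ℕ → Set
Point n = Vec Bool n

_⊕_ : {n : ℕ} → Point n → Point n → Point n
_⊕_ = zipWith _xor_

binom≤ : ℕ → ℕ → ℕ
binom≤ n zero = n C 0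
binom≤ n (suc k) = binom≤ n k + n C (suc k)

-- A multilinear monomial ∏_{i ∈ S} x_i is given by its variable set S ⊆ {1..n}.
Monomial : ℕ → Set
Monomial n = Subset n

evalMon : {n : ℕ} → Monomial n → Point n → Bool
evalMon S x = foldr′ _∧_ true (zipWith (λ s xi → not s ∨ xi) S x)

-- A multilinear polynomial over 𝔽₂ is a sum of monomials (a list of monomials,
-- coefficient 1 each; repeated monomials cancel mod 2).
MPoly : ℕ → Set
MPoly n = List (Monomial n)

evalPoly : {n : ℕ} → MPoly n → Point n → Bool
evalPoly P x = foldr (λ S acc → evalMon S x xor acc) false P

DegLe : {n : ℕ} → MPoly n → ℕ → Set
DegLe P d = All (λ S → ∣ S ∣ ≤ d) P

-- A set B ⊆ 𝔽₂ⁿ given as a predicate.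
-- int-deg(B) ≤ d : every function B → 𝔽₂ agrees on B with a polynomial of degree ≤ d.
-- (Functions on B are given as functions on 𝔽₂ⁿ; only their values on B matter.)
IntDegLe : {n : ℕ} → (Point n → Set) → ℕ → Set
IntDegLe {n} B d =
  (f : Point n → Bool) →
  Σ (MPoly n) (λ P → DegLe P d × ((b : Point n) → B b → evalPoly P b ≡ f b))

SumSet : {n : ℕ} → List (Point n) → Point n → Set
SumSet A x = Σ _ (λ a → Σ _ (λ b → a ∈ A × b ∈ A × x ≡ a ⊕ b))

module Submission where

-- Proof idea (a rank argument over 𝔽₂).  Put h = ⌊d/2⌋ and suppose that P, of
-- degree ≤ d, agrees on A + A with the indicator of the origin.  Consider the
-- A × A matrix M(a, b) = P(a + b).  Since a + a = 0 and a + b ≠ 0 for a ≠ b,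
-- M is the identity matrix, of rank |A|.  On the other hand, expanding each
-- monomial (x + y)^S = Σ_{T ⊎ U = S} x^T y^U, every term has |T| + |U| ≤ d, so
-- |T| ≤ h or |U| ≤ h.  Grouping the terms by their small monomial writes
--   P(x + y) = Σ_{|T| ≤ h} x^T G_T(y) + Σ_{|U| ≤ h} H_U(x) y^U,
-- a sum of 2·binom≤(n, h) products f(x)·g(y); hence |A| ≤ 2·binom≤(n, h).

open import Defs
open import Algebra.Bundles using (CommutativeRing)
open import Data.Bool using (Bool; true; false; _∧_; _xor_)
open import Data.Bool.Properties
  using (xor-∧-commutativeRing; xor-same; xor-identityʳ; xor-assoc; ∧-assoc; ∧-comm; ∧-zeroʳ;
         ∧-identityʳ; ∧-distribˡ-xor; ∧-distribʳ-xor)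
  renaming (_≟_ to _≟ᵇ_)
open import Data.Fin as Fin using (Fin; zero; suc; _↑ˡ_; _↑ʳ_; funToFin; finToFun; combine)
open import Data.Fin.Properties
  using (suc-injective; 2↔Bool; injective⇒≤; funToFin-finToFin; finToFun-funToFin)
open import Data.Fin.Subset using (∣_∣)
open import Data.List using (List; []; _∷_; _++_; length; lookup; map; foldr)
open import Data.List.Properties using (length-++; length-map)
open import Data.List.Membership.Propositional using (_∈_)
open import Data.List.Membership.Propositional.Properties using (∈-lookup; ∈-map⁺; ∈-++⁺ˡ; ∈-++⁺ʳ)
open import Data.List.Relation.Unary.All as All using (All; []; _∷_)
open import Data.List.Relation.Unary.All.Properties using (map⁺; ++⁺)
open import Data.List.Relation.Unary.Any using (here; index)
open import Data.List.Relation.Unary.Any.Properties using (lookup-index)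
open import Data.List.Relation.Unary.AllPairs using (_∷_)
open import Data.List.Relation.Unary.Unique.Propositional using (Unique)
open import Data.Nat using (ℕ; zero; suc; _+_; _*_; _^_; _/_; _≤_; _<_; z≤n; s≤s; _≤?_)
open import Data.Nat.Combinatorics using (_C_; nC1≡n; nCk+nC[k+1]≡[n+1]C[k+1])
open import Data.Nat.DivMod using (m*n/n≡m; /-monoˡ-≤)
open import Data.Nat.Properties
  using (+-identityʳ; +-suc; +-comm; *-comm; +-mono-≤; ≤-trans; ≤-reflexive; <⇒≱; ≰⇒>; ^-monoʳ-<; <-irrefl)
open import Data.Nat.Solver using (module +-*-Solver)
open import Data.Product using (_×_; _,_; proj₁; proj₂)
open import Data.Sum using (_⊎_; inj₁; inj₂)
open import Data.Vec using ([]; _∷_; replicate)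
open import Data.Vec.Properties using (≡-dec; ∷-injectiveˡ; ∷-injectiveʳ)
open import Data.Vec.Functional using (Vector) renaming (_++_ to _++ᵛ_)
open import Data.Vec.Functional.Properties using (lookup-++ˡ; lookup-++ʳ)
open import Function using (_∘_; Inverse)
open import Relation.Binary.PropositionalEquality
  using (_≡_; _≢_; _≗_; refl; sym; trans; cong; cong₂; subst; module ≡-Reasoning)
open import Relation.Nullary using (¬_; Dec; yes; no; does; contradiction)
open import Relation.Nullary.Decidable using (dec-true; dec-false)

open CommutativeRing xor-∧-commutativeRing using (semiring; +-commutativeSemigroup; *-commutativeSemigroup)
open import Algebra.Properties.Semiring.Sum semiring
  using (sum; sum-cong-≗; sum-replicate-zero; ∑-distrib-+; ∑-comm; *-distribˡ-sum; *-distribʳ-sum)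
open import Algebra.Properties.CommutativeSemigroup +-commutativeSemigroup using (interchange)
open import Algebra.Properties.CommutativeSemigroup *-commutativeSemigroup using () renaming (x∙yz≈y∙xz to ∧-swap)

open ≡-Reasoning

sum-single : ∀ {k} (f : Fin k → Bool) (j : Fin k) →
             (∀ i → i ≢ j → f i ≡ false) → sum f ≡ f j
sum-single {suc k} f zero others = begin
  f zero xor sum (f ∘ suc)         ≡⟨ cong (f zero xor_) (sum-cong-≗ {k} (λ i → others (suc i) λ ())) ⟩
  f zero xor sum {k} (λ _ → false) ≡⟨ cong (f zero xor_) (sum-replicate-zero k) ⟩
  f zero xor false                 ≡⟨ xor-identityʳ (f zero) ⟩
  f zero                           ∎
sum-single {suc k} f (suc j) others = begin
  f zero xor sum (f ∘ suc)         ≡⟨ cong (_xor sum (f ∘ suc)) (others zero λ ()) ⟩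
  sum (f ∘ suc)                    ≡⟨ sum-single (f ∘ suc) j (λ i i≢j → others (suc i) (i≢j ∘ suc-injective)) ⟩
  f (suc j)                        ∎

sum-+ : ∀ r {s} (f : Fin (r + s) → Bool) →
        sum f ≡ sum (λ i → f (i ↑ˡ s)) xor sum (λ i → f (r ↑ʳ i))
sum-+ zero    f = refl
sum-+ (suc r) f = trans (cong (f zero xor_) (sum-+ r (f ∘ suc)))
                        (sym (xor-assoc (f zero) _ _))

-- Counting Boolean vectors: an injective map 𝔽₂^m → 𝔽₂^r forces 2^m ≤ 2^r, hence m ≤ r.
module BooleanCode where
  module Bit = Inverse 2↔Bool

  code : ∀ {m} → Vector Bool m → Fin (2 ^ m)
  code X = funToFin (Bit.from ∘ X)

  decode : ∀ {m} → Fin (2 ^ m) → Vector Bool m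
  decode i = Bit.to ∘ finToFun i

  funToFin-cong : ∀ {m n} {f g : Fin m → Fin n} → f ≗ g → funToFin f ≡ funToFin g
  funToFin-cong {zero}  f≗g = refl
  funToFin-cong {suc m} f≗g = cong₂ combine (f≗g zero) (funToFin-cong (f≗g ∘ suc))

  code-cong : ∀ {m} {X Y : Vector Bool m} → X ≗ Y → code X ≡ code Y
  code-cong X≗Y = funToFin-cong (cong Bit.from ∘ X≗Y)

  code-injective : ∀ {m} (X Y : Vector Bool m) → code X ≡ code Y → X ≗ Y
  code-injective X Y codes≡ j = begin
    X j                               ≡⟨ sym (Bit.strictlyInverseˡ (X j)) ⟩
    Bit.to (Bit.from (X j))           ≡⟨ cong Bit.to (sym (finToFun-funToFin (Bit.from ∘ X) j)) ⟩
    Bit.to (finToFun (code X) j)      ≡⟨ cong (λ c → Bit.to (finToFun c j)) codes≡ ⟩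
    Bit.to (finToFun (code Y) j)      ≡⟨ cong Bit.to (finToFun-funToFin (Bit.from ∘ Y) j) ⟩
    Bit.to (Bit.from (Y j))           ≡⟨ Bit.strictlyInverseˡ (Y j) ⟩
    Y j                               ∎

  code-decode : ∀ {m} (i : Fin (2 ^ m)) → code (decode {m} i) ≡ i
  code-decode {m} i = trans (funToFin-cong {m} (Bit.strictlyInverseʳ ∘ finToFun i)) (funToFin-finToFin {m} i)

  2^-reflects-≤ : ∀ {m r} → 2 ^ m ≤ 2 ^ r → m ≤ r
  2^-reflects-≤ {m} {r} 2^m≤2^r with m ≤? r
  ... | yes m≤r = m≤r
  ... | no  m≰r = contradiction 2^m≤2^r (<⇒≱ (^-monoʳ-< 2 (s≤s (s≤s z≤n)) (≰⇒> m≰r)))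

  injection⇒≤ : ∀ {m r} (f : Vector Bool m → Vector Bool r) →
                (∀ X Y → f X ≗ f Y → X ≗ Y) → m ≤ r
  injection⇒≤ {m} {r} f f-injective = 2^-reflects-≤ (injective⇒≤ {f = coded} coded-injective)
    where
    coded : Fin (2 ^ m) → Fin (2 ^ r)
    coded = code ∘ f ∘ decode {m}

    coded-injective : ∀ {i j} → coded i ≡ coded j → i ≡ j
    coded-injective {i} {j} coded≡ = begin
      i                   ≡⟨ sym (code-decode {m} i) ⟩
      code (decode {m} i) ≡⟨ code-cong (f-injective _ _ (code-injective _ _ coded≡)) ⟩
      code (decode {m} j) ≡⟨ code-decode {m} j ⟩
      j                   ∎

open BooleanCode using (injection⇒≤)

-- Biorthogonal families: if u₁ … u_m and w₁ … w_m in 𝔽₂^r satisfy ⟨u_i, w_l⟩ = δ_il,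
-- then m ≤ r, because X ↦ Σ_i X_i u_i is injective: X_l = ⟨Σ_i X_i u_i, w_l⟩.
biorthogonal⇒≤ : ∀ {m r} (u w : Fin m → Fin r → Bool) →
                 (∀ i → sum (λ j → u i j ∧ w i j) ≡ true) →
                 (∀ i l → i ≢ l → sum (λ j → u i j ∧ w l j) ≡ false) →
                 m ≤ r
biorthogonal⇒≤ {m} {r} u w diagonal off-diagonal = injection⇒≤ combination combination-injective
  where
  combination : Vector Bool m → Vector Bool r
  combination X j = sum (λ i → X i ∧ u i j)

  recover : ∀ X l → sum (λ j → combination X j ∧ w l j) ≡ X l
  recover X l = begin
    sum (λ j → sum (λ i → X i ∧ u i j) ∧ w l j)
      ≡⟨ sum-cong-≗ (λ j → *-distribʳ-sum (w l j) (λ i → X i ∧ u i j)) ⟩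
    sum (λ j → sum (λ i → (X i ∧ u i j) ∧ w l j))
      ≡⟨ ∑-comm (λ j i → (X i ∧ u i j) ∧ w l j) ⟩
    sum (λ i → sum (λ j → (X i ∧ u i j) ∧ w l j))
      ≡⟨ sum-cong-≗ (λ i → trans (sum-cong-≗ (λ j → ∧-assoc (X i) (u i j) (w l j)))
                                 (sym (*-distribˡ-sum (X i) (λ j → u i j ∧ w l j)))) ⟩
    sum (λ i → X i ∧ sum (λ j → u i j ∧ w l j))
      ≡⟨ sum-single _ l (λ i i≢l → trans (cong (X i ∧_) (off-diagonal i l i≢l)) (∧-zeroʳ (X i))) ⟩
    X l ∧ sum (λ j → u l j ∧ w l j)
      ≡⟨ trans (cong (X l ∧_) (diagonal l)) (∧-identityʳ (X l)) ⟩
    X l ∎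

  combination-injective : ∀ X Y → combination X ≗ combination Y → X ≗ Y
  combination-injective X Y same l = begin
    X l                                       ≡⟨ sym (recover X l) ⟩
    sum (λ j → combination X j ∧ w l j)       ≡⟨ sum-cong-≗ (λ j → cong (_∧ w l j) (same j)) ⟩
    sum (λ j → combination Y j ∧ w l j)       ≡⟨ recover Y l ⟩
    Y l                                       ∎

-- A factorisation of length r of M : X → Y → 𝔽₂ writes M(x, y) = Σ_{i<r} c_i(x) v_i(y);
-- it exists iff M, viewed as an X × Y matrix over 𝔽₂, has rank at most r.
record Factorisation {X Y : Set} (r : ℕ) (M : X → Y → Bool) : Set where
  field
    left       : Fin r → X → Bool
    right      : Fin r → Y → Bool
    factorises : ∀ x y → M x y ≡ sum (λ i → left i x ∧ right i y)

lookup-injective : ∀ {X : Set} (A : List X) → Unique A →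
                   ∀ i j → lookup A i ≡ lookup A j → i ≡ j
lookup-injective (a ∷ A) (_   ∷ _)      zero    zero    _    = refl
lookup-injective (a ∷ A) (a∉A ∷ _)      zero    (suc j) a≡Aj = contradiction a≡Aj (All.lookup a∉A (∈-lookup j))
lookup-injective (a ∷ A) (a∉A ∷ _)      (suc i) zero    Ai≡a = contradiction (sym Ai≡a) (All.lookup a∉A (∈-lookup i))
lookup-injective (a ∷ A) (_   ∷ unique) (suc i) (suc j) Ai≡Aj = cong suc (lookup-injective A unique i j Ai≡Aj)

identity⇒length≤rank : ∀ {X : Set} {r} {M : X → X → Bool} (A : List X) → Unique A →
                       Factorisation r M →
                       (∀ {a} → a ∈ A → M a a ≡ true) →
                       (∀ {a b} → a ∈ A → b ∈ A → a ≢ b → M a b ≡ false) →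
                       length A ≤ r
identity⇒length≤rank {X} A unique F diagonal off-diagonal =
  biorthogonal⇒≤ (λ i j → left j (point i)) (λ l j → right j (point l))
    (λ i → trans (sym (factorises _ _)) (diagonal (∈-lookup i)))
    (λ i l i≢l → trans (sym (factorises _ _))
      (off-diagonal (∈-lookup i) (∈-lookup l) (i≢l ∘ lookup-injective A unique i l)))
  where
  open Factorisation F
  point : Fin (length A) → X
  point = lookup A

module Buckets {X : Set} {ℓ : ℕ} (b : Fin ℓ → X → Bool) where

  record Bucketed (M : X → X → Bool) : Set where
    field
      G H        : Fin ℓ → X → Bool
      decomposes : ∀ x y → M x y ≡ sum (λ i → b i x ∧ G i y) xor sum (λ i → H i x ∧ b i y)

  open Bucketed

  bucketed-cong : ∀ {M N} → (∀ x y → M x y ≡ N x y) → Bucketed M → Bucketed N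
  bucketed-cong M≡N B = record
    { G = G B ; H = H B ; decomposes = λ x y → trans (sym (M≡N x y)) (decomposes B x y) }

  bucketed-zero : Bucketed (λ _ _ → false)
  bucketed-zero = record
    { G = λ _ _ → false ; H = λ _ _ → false
    ; decomposes = λ x y → sym (cong₂ _xor_
        (trans (sum-cong-≗ (λ i → ∧-zeroʳ (b i x))) (sum-replicate-zero ℓ))
        (sum-replicate-zero ℓ)) }

  bucketed-xor : ∀ {M N} → Bucketed M → Bucketed N → Bucketed (λ x y → M x y xor N x y)
  bucketed-xor {M} {N} BM BN = record
    { G = λ i y → G BM i y xor G BN i y ; H = λ i x → H BM i x xor H BN i x ; decomposes = sums }
    where
    sums : ∀ x y → M x y xor N x y ≡
           sum (λ i → b i x ∧ (G BM i y xor G BN i y)) xor sum (λ i → (H BM i x xor H BN i x) ∧ b i y)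
    sums x y = begin
      M x y xor N x y
        ≡⟨ cong₂ _xor_ (decomposes BM x y) (decomposes BN x y) ⟩
      (sum bG₁ xor sum Hb₁) xor (sum bG₂ xor sum Hb₂)
        ≡⟨ interchange (sum bG₁) (sum Hb₁) (sum bG₂) (sum Hb₂) ⟩
      (sum bG₁ xor sum bG₂) xor (sum Hb₁ xor sum Hb₂)
        ≡⟨ sym (cong₂ _xor_ (∑-distrib-+ bG₁ bG₂) (∑-distrib-+ Hb₁ Hb₂)) ⟩
      sum (λ i → bG₁ i xor bG₂ i) xor sum (λ i → Hb₁ i xor Hb₂ i)
        ≡⟨ sym (cong₂ _xor_ (sum-cong-≗ (λ i → ∧-distribˡ-xor (b i x) (G BM i y) (G BN i y)))
                            (sum-cong-≗ (λ i → ∧-distribʳ-xor (b i y) (H BM i x) (H BN i x)))) ⟩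
      sum (λ i → b i x ∧ (G BM i y xor G BN i y)) xor sum (λ i → (H BM i x xor H BN i x) ∧ b i y) ∎
      where
      bG₁ bG₂ Hb₁ Hb₂ : Fin ℓ → Bool
      bG₁ i = b i x ∧ G BM i y
      bG₂ i = b i x ∧ G BN i y
      Hb₁ i = H BM i x ∧ b i y
      Hb₂ i = H BN i x ∧ b i y

  at : Fin ℓ → Fin ℓ → Bool
  at j i = does (i Fin.≟ j)

  sum-at : ∀ j (f : Fin ℓ → Bool) → sum (λ i → f i ∧ at j i) ≡ f j
  sum-at j f = begin
    sum (λ i → f i ∧ at j i)  ≡⟨ sum-single _ j (λ i i≢j → trans (cong (f i ∧_) (dec-false (i Fin.≟ j) i≢j)) (∧-zeroʳ (f i))) ⟩
    f j ∧ at j j              ≡⟨ cong (f j ∧_) (dec-true (j Fin.≟ j) refl) ⟩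
    f j ∧ true                ≡⟨ ∧-identityʳ (f j) ⟩
    f j                       ∎

  bucketed-left : ∀ j (g : X → Bool) → Bucketed (λ x y → b j x ∧ g y)
  bucketed-left j g = record
    { G = λ i y → at j i ∧ g y ; H = λ _ _ → false
    ; decomposes = λ x y → sym (begin
        sum (λ i → b i x ∧ (at j i ∧ g y)) xor sum {ℓ} (λ _ → false)
          ≡⟨ cong₂ _xor_ (sum-cong-≗ (λ i → sym (∧-assoc (b i x) (at j i) (g y)))) (sum-replicate-zero ℓ) ⟩
        sum (λ i → (b i x ∧ at j i) ∧ g y) xor false
          ≡⟨ xor-identityʳ _ ⟩
        sum (λ i → (b i x ∧ at j i) ∧ g y)
          ≡⟨ sym (*-distribʳ-sum (g y) (λ i → b i x ∧ at j i)) ⟩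
        sum (λ i → b i x ∧ at j i) ∧ g y
          ≡⟨ cong (_∧ g y) (sum-at j (λ i → b i x)) ⟩
        b j x ∧ g y ∎) }

  bucketed-right : ∀ j (h : X → Bool) → Bucketed (λ x y → h x ∧ b j y)
  bucketed-right j h = record
    { G = λ _ _ → false ; H = λ i x → h x ∧ at j i
    ; decomposes = λ x y → sym (begin
        sum (λ i → b i x ∧ false) xor sum (λ i → (h x ∧ at j i) ∧ b i y)
          ≡⟨ cong (_xor sum (λ i → (h x ∧ at j i) ∧ b i y))
                  (trans (sum-cong-≗ (λ i → ∧-zeroʳ (b i x))) (sum-replicate-zero ℓ)) ⟩
        sum (λ i → (h x ∧ at j i) ∧ b i y)
          ≡⟨ sum-cong-≗ (λ i → trans (∧-assoc (h x) (at j i) (b i y))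
                                     (cong (h x ∧_) (∧-comm (at j i) (b i y)))) ⟩
        sum (λ i → h x ∧ (b i y ∧ at j i))
          ≡⟨ sym (*-distribˡ-sum (h x) (λ i → b i y ∧ at j i)) ⟩
        h x ∧ sum (λ i → b i y ∧ at j i)
          ≡⟨ cong (h x ∧_) (sum-at j (λ i → b i y)) ⟩
        h x ∧ b j y ∎) }

  bucketed⇒factorisation : ∀ {M} → Bucketed M → Factorisation (ℓ + ℓ) M
  bucketed⇒factorisation {M} B = record
    { left = b ++ᵛ H B ; right = G B ++ᵛ b ; factorises = concatenated }
    where
    concatenated : ∀ x y → M x y ≡ sum (λ i → (b ++ᵛ H B) i x ∧ (G B ++ᵛ b) i y)
    concatenated x y = begin
      M x y
        ≡⟨ decomposes B x y ⟩
      sum (λ i → b i x ∧ G B i y) xor sum (λ i → H B i x ∧ b i y)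
        ≡⟨ sym (cong₂ _xor_
             (sum-cong-≗ (λ i → cong₂ (λ c v → c x ∧ v y) (lookup-++ˡ b (H B) i) (lookup-++ˡ (G B) b i)))
             (sum-cong-≗ (λ i → cong₂ (λ c v → c x ∧ v y) (lookup-++ʳ b (H B) i) (lookup-++ʳ (G B) b i)))) ⟩
      sum (λ i → (b ++ᵛ H B) (i ↑ˡ ℓ) x ∧ (G B ++ᵛ b) (i ↑ˡ ℓ) y)
        xor sum (λ i → (b ++ᵛ H B) (ℓ ↑ʳ i) x ∧ (G B ++ᵛ b) (ℓ ↑ʳ i) y)
        ≡⟨ sym (sum-+ ℓ (λ i → (b ++ᵛ H B) i x ∧ (G B ++ᵛ b) i y)) ⟩
      sum (λ i → (b ++ᵛ H B) i x ∧ (G B ++ᵛ b) i y) ∎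

  bucketed-foldr : ∀ {E : Set} (es : List E) {F : E → X → X → Bool} → All (λ e → Bucketed (F e)) es →
                   Bucketed (λ x y → foldr (λ e acc → F e x y xor acc) false es)
  bucketed-foldr []       []         = bucketed-zero
  bucketed-foldr (e ∷ es) (Be ∷ Bes) = bucketed-xor Be (bucketed-foldr es Bes)

open Buckets using (Bucketed; bucketed-cong; bucketed-left; bucketed-right; bucketed⇒factorisation; bucketed-foldr)

monomialsUpTo : (n k : ℕ) → List (Monomial n)
monomialsUpTo zero    k       = [] ∷ []
monomialsUpTo (suc n) zero    = map (false ∷_) (monomialsUpTo n zero)
monomialsUpTo (suc n) (suc k) = map (false ∷_) (monomialsUpTo n (suc k)) ++ map (true ∷_) (monomialsUpTo n k)

∈-monomialsUpTo : ∀ {n} k (T : Monomial n) → ∣ T ∣ ≤ k → T ∈ monomialsUpTo n k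
∈-monomialsUpTo k       []          _         = here refl
∈-monomialsUpTo zero    (false ∷ T) deg       = ∈-map⁺ (false ∷_) (∈-monomialsUpTo zero T deg)
∈-monomialsUpTo (suc k) (false ∷ T) deg       = ∈-++⁺ˡ (∈-map⁺ (false ∷_) (∈-monomialsUpTo (suc k) T deg))
∈-monomialsUpTo (suc k) (true ∷ T)  (s≤s deg) = ∈-++⁺ʳ _ (∈-map⁺ (true ∷_) (∈-monomialsUpTo k T deg))

binom≤-zero : ∀ k → binom≤ 0 k ≡ 1
binom≤-zero zero    = refl
binom≤-zero (suc k) = trans (+-identityʳ (binom≤ 0 k)) (binom≤-zero k)

binom≤-pascal : ∀ n k → binom≤ (suc n) (suc k) ≡ binom≤ n (suc k) + binom≤ n k
binom≤-pascal n zero = begin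
  1 + suc n C 1          ≡⟨ cong (1 +_) (nC1≡n (suc n)) ⟩
  suc (suc n)            ≡⟨ cong suc (+-comm 1 n) ⟩
  suc (n + 1)            ≡⟨ cong (λ m → suc m + 1) (sym (nC1≡n n)) ⟩
  (1 + n C 1) + 1        ∎
binom≤-pascal n (suc k) = begin
  binom≤ (suc n) (suc k) + suc n C suc (suc k)
    ≡⟨ cong₂ _+_ (binom≤-pascal n k) (sym (nCk+nC[k+1]≡[n+1]C[k+1] n (suc k))) ⟩
  (binom≤ n (suc k) + binom≤ n k) + (n C suc k + n C suc (suc k))
    ≡⟨ rearrange (binom≤ n (suc k)) (binom≤ n k) (n C suc k) (n C suc (suc k)) ⟩
  (binom≤ n (suc k) + n C suc (suc k)) + (binom≤ n k + n C suc k) ∎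
  where
  open +-*-Solver
  rearrange : ∀ a b c d → (a + b) + (c + d) ≡ (a + d) + (b + c)
  rearrange = solve 4 (λ a b c d → (a :+ b) :+ (c :+ d) := (a :+ d) :+ (b :+ c)) refl

length-monomialsUpTo : ∀ n k → length (monomialsUpTo n k) ≡ binom≤ n k
length-monomialsUpTo zero    k       = sym (binom≤-zero k)
length-monomialsUpTo (suc n) zero    = trans (length-map (false ∷_) (monomialsUpTo n zero)) (length-monomialsUpTo n zero)
length-monomialsUpTo (suc n) (suc k) = begin
  length (map (false ∷_) (monomialsUpTo n (suc k)) ++ map (true ∷_) (monomialsUpTo n k))
    ≡⟨ length-++ (map (false ∷_) (monomialsUpTo n (suc k))) ⟩
  length (map (false ∷_) (monomialsUpTo n (suc k))) + length (map (true ∷_) (monomialsUpTo n k))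
    ≡⟨ cong₂ _+_ (trans (length-map (false ∷_) (monomialsUpTo n (suc k))) (length-monomialsUpTo n (suc k)))
                 (trans (length-map (true ∷_) (monomialsUpTo n k)) (length-monomialsUpTo n k)) ⟩
  binom≤ n (suc k) + binom≤ n k
    ≡⟨ sym (binom≤-pascal n k) ⟩
  binom≤ (suc n) (suc k) ∎

-- Binomial expansion of a multilinear monomial in x + y:
--   (x + y)^S = Σ_{(T, U) ∈ splittings S} x^T y^U,
-- where the splittings are the ways of distributing the variables of S between T and U.
Splitting : ℕ → Set
Splitting n = Monomial n × Monomial n

bimonomial : ∀ {n} → Splitting n → Point n → Point n → Bool
bimonomial p x y = evalMon (proj₁ p) x ∧ evalMon (proj₂ p) y

bisum : ∀ {n} → List (Splitting n) → Point n → Point n → Bool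
bisum E x y = foldr (λ p acc → bimonomial p x y xor acc) false E

extend : ∀ {n} → Bool → Bool → Splitting n → Splitting (suc n)
extend s t p = (s ∷ proj₁ p , t ∷ proj₂ p)

splittings : ∀ {n} → Monomial n → List (Splitting n)
splittings []          = ([] , []) ∷ []
splittings (false ∷ S) = map (extend false false) (splittings S)
splittings (true ∷ S)  = map (extend true false) (splittings S) ++ map (extend false true) (splittings S)

bisum-++ : ∀ {n} (E F : List (Splitting n)) x y → bisum (E ++ F) x y ≡ bisum E x y xor bisum F x y
bisum-++ []      F x y = refl
bisum-++ (p ∷ E) F x y = trans (cong (bimonomial p x y xor_) (bisum-++ E F x y))
                               (sym (xor-assoc (bimonomial p x y) _ _))

bisum-map : ∀ {m n} (g : Splitting m → Splitting n) c (E : List (Splitting m)) x y x′ y′ →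
            (∀ p → bimonomial (g p) x′ y′ ≡ c ∧ bimonomial p x y) →
            bisum (map g E) x′ y′ ≡ c ∧ bisum E x y
bisum-map g c []      x y x′ y′ termwise = sym (∧-zeroʳ c)
bisum-map g c (p ∷ E) x y x′ y′ termwise = begin
  bimonomial (g p) x′ y′ xor bisum (map g E) x′ y′
    ≡⟨ cong₂ _xor_ (termwise p) (bisum-map g c E x y x′ y′ termwise) ⟩
  (c ∧ bimonomial p x y) xor (c ∧ bisum E x y)
    ≡⟨ sym (∧-distribˡ-xor c (bimonomial p x y) (bisum E x y)) ⟩
  c ∧ bisum (p ∷ E) x y ∎

-- The expansion itself: a new variable x₀ + y₀ of S contributes x₀ to T or y₀ to U.
evalMon-⊕ : ∀ {n} (S : Monomial n) (x y : Point n) → evalMon S (x ⊕ y) ≡ bisum (splittings S) x y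
evalMon-⊕ []          []       []       = refl
evalMon-⊕ (false ∷ S) (x₀ ∷ x) (y₀ ∷ y) =
  trans (evalMon-⊕ S x y) (sym (bisum-map (extend false false) true (splittings S) x y _ _ (λ _ → refl)))
evalMon-⊕ (true ∷ S)  (x₀ ∷ x) (y₀ ∷ y) = begin
  (x₀ xor y₀) ∧ evalMon S (x ⊕ y)
    ≡⟨ cong ((x₀ xor y₀) ∧_) (evalMon-⊕ S x y) ⟩
  (x₀ xor y₀) ∧ bisum E x y
    ≡⟨ ∧-distribʳ-xor (bisum E x y) x₀ y₀ ⟩
  (x₀ ∧ bisum E x y) xor (y₀ ∧ bisum E x y)
    ≡⟨ sym (cong₂ _xor_
         (bisum-map (extend true false) x₀ E x y _ _ (λ p → ∧-assoc x₀ (evalMon (proj₁ p) x) _))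
         (bisum-map (extend false true) y₀ E x y _ _ (λ p → ∧-swap (evalMon (proj₁ p) x) y₀ _))) ⟩
  bisum (map (extend true false) E) (x₀ ∷ x) (y₀ ∷ y) xor bisum (map (extend false true) E) (x₀ ∷ x) (y₀ ∷ y)
    ≡⟨ sym (bisum-++ (map (extend true false) E) _ _ _) ⟩
  bisum (splittings (true ∷ S)) (x₀ ∷ x) (y₀ ∷ y) ∎
  where
  E : List (Splitting _)
  E = splittings S

splittings-size : ∀ {n} (S : Monomial n) → All (λ p → ∣ proj₁ p ∣ + ∣ proj₂ p ∣ ≡ ∣ S ∣) (splittings S)
splittings-size []          = refl ∷ []
splittings-size (false ∷ S) = map⁺ (splittings-size S)
splittings-size (true ∷ S)  = ++⁺ (map⁺ (All.map (cong suc) (splittings-size S)))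
                                  (map⁺ (All.map (λ {p} size → trans (+-suc ∣ proj₁ p ∣ _) (cong suc size))
                                                 (splittings-size S)))

one-side-small : ∀ {a b} d → a + b ≤ d → a ≤ d / 2 ⊎ b ≤ d / 2
one-side-small {a} {b} d a+b≤d with a ≤? d / 2 | b ≤? d / 2
... | yes a≤h | _       = inj₁ a≤h
... | no  _   | yes b≤h = inj₂ b≤h
... | no  a≰h | no  b≰h = contradiction 1+h≤h (<-irrefl refl)
  where
  h : ℕ
  h = d / 2
  -- both parts exceeding h would give 2(h + 1) ≤ a + b ≤ d, i.e. h + 1 ≤ ⌊d/2⌋ = h
  twice : suc h * 2 ≡ suc h + suc h
  twice = trans (*-comm (suc h) 2) (cong (suc h +_) (+-identityʳ (suc h)))
  1+h≤h : suc h ≤ h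
  1+h≤h = subst (_≤ h) (m*n/n≡m (suc h) 2)
            (/-monoˡ-≤ 2 (≤-trans (≤-reflexive twice) (≤-trans (+-mono-≤ (≰⇒> a≰h) (≰⇒> b≰h)) a+b≤d)))

lowDegree : ∀ n h → Fin (length (monomialsUpTo n h)) → Point n → Bool
lowDegree n h = evalMon ∘ lookup (monomialsUpTo n h)

bimonomial-bucketed : ∀ {n} h (p : Splitting n) → ∣ proj₁ p ∣ ≤ h ⊎ ∣ proj₂ p ∣ ≤ h →
                      Bucketed (lowDegree n h) (bimonomial p)
bimonomial-bucketed {n} h (T , U) (inj₁ T-small) =
  bucketed-cong (lowDegree n h) (λ x y → cong (λ S → evalMon S x ∧ evalMon U y) (sym (lookup-index T∈)))
    (bucketed-left (lowDegree n h) (index T∈) (evalMon U))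
  where T∈ = ∈-monomialsUpTo h T T-small
bimonomial-bucketed {n} h (T , U) (inj₂ U-small) =
  bucketed-cong (lowDegree n h) (λ x y → cong (λ S → evalMon T x ∧ evalMon S y) (sym (lookup-index U∈)))
    (bucketed-right (lowDegree n h) (index U∈) (evalMon T))
  where U∈ = ∈-monomialsUpTo h U U-small

-- For a polynomial P of degree ≤ d, (x, y) ↦ P(x + y) is bucketed by the monomials of
-- degree ≤ ⌊d/2⌋: expand each monomial and split every term on its smaller side.
polynomial-bucketed : ∀ {n} d (P : MPoly n) → DegLe P d →
                      Bucketed (lowDegree n (d / 2)) (λ x y → evalPoly P (x ⊕ y))
polynomial-bucketed {n} d P deg = bucketed-foldr (lowDegree n (d / 2)) P (All.map (λ {S} → monomial-bucketed S) deg)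
  where
  monomial-bucketed : ∀ S → ∣ S ∣ ≤ d → Bucketed (lowDegree n (d / 2)) (λ x y → evalMon S (x ⊕ y))
  monomial-bucketed S S≤d =
    bucketed-cong (lowDegree n (d / 2)) (λ x y → sym (evalMon-⊕ S x y))
      (bucketed-foldr (lowDegree n (d / 2)) (splittings S)
        (All.map (λ {p} size → bimonomial-bucketed (d / 2) p
                                 (one-side-small d (subst (_≤ d) (sym size) S≤d)))
                 (splittings-size S)))

origin : ∀ {n} → Point n
origin {n} = replicate n false

_≟ᵖ_ : ∀ {n} (x y : Point n) → Dec (x ≡ y)
_≟ᵖ_ = ≡-dec _≟ᵇ_

isOrigin : ∀ {n} → Point n → Bool
isOrigin z = does (z ≟ᵖ origin)

⊕-self : ∀ {n} (a : Point n) → a ⊕ a ≡ origin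
⊕-self []      = refl
⊕-self (x ∷ a) = cong₂ _∷_ (xor-same x) (⊕-self a)

⊕≡origin⇒≡ : ∀ {n} (a b : Point n) → a ⊕ b ≡ origin → a ≡ b
⊕≡origin⇒≡ []      []      _ = refl
⊕≡origin⇒≡ (x ∷ a) (y ∷ b) e = cong₂ _∷_ (xor≡false⇒≡ x y (∷-injectiveˡ e)) (⊕≡origin⇒≡ a b (∷-injectiveʳ e))
  where
  xor≡false⇒≡ : ∀ x y → x xor y ≡ false → x ≡ y
  xor≡false⇒≡ false false _ = refl
  xor≡false⇒≡ true  true  _ = refl

module OriginInterpolant {n} (A : List (Point n)) (P : MPoly n)
                         (agrees : ∀ z → SumSet A z → evalPoly P z ≡ isOrigin z) where

  sum∈A+A : ∀ {a b} → a ∈ A → b ∈ A → SumSet A (a ⊕ b)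
  sum∈A+A a∈A b∈A = _ , _ , a∈A , b∈A , refl

  diagonal : ∀ {a} → a ∈ A → evalPoly P (a ⊕ a) ≡ true
  diagonal {a} a∈A = trans (agrees _ (sum∈A+A a∈A a∈A)) (dec-true (_ ≟ᵖ _) (⊕-self a))

  off-diagonal : ∀ {a b} → a ∈ A → b ∈ A → a ≢ b → evalPoly P (a ⊕ b) ≡ false
  off-diagonal {a} {b} a∈A b∈A a≢b =
    trans (agrees _ (sum∈A+A a∈A b∈A)) (dec-false (_ ≟ᵖ _) (a≢b ∘ ⊕≡origin⇒≡ a b))

theorem3 : (n d : ℕ) → d ≤ n → (A : List (Point n)) → Unique A →
    2 * binom≤ n (d / 2) < length A →
    ¬ IntDegLe (SumSet A) d
theorem3 n d _ A unique large interpolation with interpolation isOrigin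
... | P , deg , agrees = <⇒≱ large (subst (length A ≤_) 2ℓ≡2B |A|≤2ℓ)
  where
  open OriginInterpolant A P agrees

  |A|≤2ℓ : length A ≤ length (monomialsUpTo n (d / 2)) + length (monomialsUpTo n (d / 2))
  |A|≤2ℓ = identity⇒length≤rank A unique
             (bucketed⇒factorisation (lowDegree n (d / 2)) (polynomial-bucketed d P deg))
             diagonal off-diagonal

  2ℓ≡2B : length (monomialsUpTo n (d / 2)) + length (monomialsUpTo n (d / 2)) ≡ 2 * binom≤ n (d / 2)
  2ℓ≡2B = trans (cong (λ k → k + k) (length-monomialsUpTo n (d / 2)))
                (cong (binom≤ n (d / 2) +_) (sym (+-identityʳ (binom≤ n (d / 2)))))
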